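{- Let $m,n,k$ be positive integers and $d$ an integer. Consider the following procedure RepPIW$(m,n,k,d)$. Let $L_1$ be the list of all minimal $1\times n$ integer vectors $v$ with $vv^\top=k$. For $p=1,\dots,m-1$: for each $X\in L_p$ (a $p\times n$ matrix with last row $X_p$) and each $w\in\mathbb{Z}^n$ with $ww^\top=k$, $w>X_p$ (lexicographically) and $w$ orthogonal to every row of $X$, form the $(p+1)\times n$ matrix $X_{new}$ obtained by appending $w$ as a new last row; if $p\le d$, append $X_{new}$ to $L_{p+1}$ only if $X_{new}$ is minimal, and if $p>d$, append $X_{new}$ to $L_{p+1}$ unconditionally. Output $L_m$. Then: (1) with $d=m$ (the default), the output $L_m$ is exactly the list of all minimal matrices in $PIW(m,n,k)$, i.e. one representative of each Hadamard equivalence class of $PIW(m,n,k)$; (2) for arbitrary $d$, the output is a list of matrices in $PIW(m,n,k)$ which contains all minimal matrices of $PIW(m,n,k)$.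
   Context: $PIW(m,n,k)=\{P\in\mathbb{Z}^{m\times n} : PP^\top=kI\}$. Integer vectors are ordered lexicographically: $v<w$ iff there is $j$ with $v_i=w_i$ for all $i<j$ and $v_j<w_j$. The row-lex ordering $\le_R$ on integer matrices of a fixed size is the lexicographic extension of this ordering to matrices viewed as the sequence of their rows. Two matrices are Hadamard equivalent if one is obtained from the other by a sequence of row/column negations and row/column swaps; $PIW(m,n,k)$ is closed under this equivalence. A matrix is minimal if it equals the $\le_R$-minimum of its Hadamard class. -}

module Defs where

open import Data.Nat using (ℕ; zero; suc)
open import Data.Integer as ℤ using (ℤ; +_; -_; _*_; _+_)
open import Data.Fin using (Fin; _≟_)
open import Data.Vec using (Vec; []; _∷_; lookup; tabulate; map; zipWith; foldr; _∷ʳ_; last; updateAt)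
open import Data.Product using (_×_)
open import Data.Sum using (_⊎_)
open import Data.Empty using (⊥)
open import Relation.Nullary using (yes; no; ¬_)
open import Relation.Binary.PropositionalEquality using (_≡_)

Matrix : ℕ → ℕ → Set
Matrix m n = Vec (Vec ℤ n) m

dot : ∀ {n} → Vec ℤ n → Vec ℤ n → ℤ
dot v w = foldr _ _+_ (+ 0) (zipWith _*_ v w)

PIW : (m n k : ℕ) → Matrix m n → Set
PIW m n k P = ∀ (i j : Fin m) →
  (i ≡ j → dot (lookup P i) (lookup P j) ≡ + k) ×
  (¬ (i ≡ j) → dot (lookup P i) (lookup P j) ≡ + 0)

Lex< : {A : Set} → (A → A → Set) → ∀ {n} → Vec A n → Vec A n → Set
Lex< _<_ [] [] = ⊥
Lex< _<_ (x ∷ xs) (y ∷ ys) = (x < y) ⊎ ((x ≡ y) × Lex< _<_ xs ys)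

_<ᵥ_ : ∀ {n} → Vec ℤ n → Vec ℤ n → Set
_<ᵥ_ = Lex< ℤ._<_

_≤R_ : ∀ {m n} → Matrix m n → Matrix m n → Set
X ≤R Y = (X ≡ Y) ⊎ Lex< _<ᵥ_ X Y

swapIx : ∀ {m} → Fin m → Fin m → Fin m → Fin m
swapIx i j r with r ≟ i
... | yes _ = j
... | no _ with r ≟ j
...   | yes _ = i
...   | no _ = r

negRow : ∀ {m n} → Fin m → Matrix m n → Matrix m n
negRow i X = updateAt X i (map -_)

negCol : ∀ {m n} → Fin n → Matrix m n → Matrix m n
negCol j X = map (λ row → updateAt row j -_) X

swapRows : ∀ {m n} → Fin m → Fin m → Matrix m n → Matrix m n
swapRows i i' X = tabulate (λ r → lookup X (swapIx i i' r))

swapCols : ∀ {m n} → Fin n → Fin n → Matrix m n → Matrix m n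
swapCols j j' X = map (λ row → tabulate (λ c → lookup row (swapIx j j' c))) X

data HEquiv {m n : ℕ} : Matrix m n → Matrix m n → Set where
  done     : ∀ {X} → HEquiv X X
  negRow⟶  : ∀ {X Y} (i : Fin m)      → HEquiv (negRow i X) Y      → HEquiv X Y
  negCol⟶  : ∀ {X Y} (j : Fin n)      → HEquiv (negCol j X) Y      → HEquiv X Y
  swapRow⟶ : ∀ {X Y} (i i' : Fin m)   → HEquiv (swapRows i i' X) Y → HEquiv X Y
  swapCol⟶ : ∀ {X Y} (j j' : Fin n)   → HEquiv (swapCols j j' X) Y → HEquiv X Y

Minimal : ∀ {m n} → Matrix m n → Set
Minimal X = ∀ Y → HEquiv X Y → X ≤R Y

-- The lists L_p produced by RepPIW(m,n,k,d), described by membership: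
-- RepL n k d p X  means  "X occurs in L_p".
data RepL (n k : ℕ) (d : ℤ) : (p : ℕ) → Matrix p n → Set where
  start : ∀ (v : Vec ℤ n) → dot v v ≡ + k → Minimal (v ∷ []) →
          RepL n k d 1 (v ∷ [])
  extend : ∀ {p} (X : Matrix (suc p) n) (w : Vec ℤ n) →
           RepL n k d (suc p) X →
           dot w w ≡ + k →
           last X <ᵥ w →
           (∀ (i : Fin (suc p)) → dot (lookup X i) w ≡ + 0) →
           (+ (suc p) ℤ.≤ d → Minimal (X ∷ʳ w)) →
           RepL n k d (suc (suc p)) (X ∷ʳ w)

-- A Hadamard operation on the first p rows of a matrix extends to the whole
-- matrix (the appended row moves only under column operations), and a row-lex
-- comparison of two matrices with one appended row each restricts to their
-- first p rows; so every initial block of rows of a minimal matrix is minimal.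
-- Swapping the last two rows of a minimal matrix shows that they increase,
-- strictly since orthogonal rows of norm k > 0 differ. Hence every minimal
-- matrix of PIW(m,n,k) is produced by RepPIW row by row, whatever d is;
-- conversely every step of RepPIW preserves PIW, and minimality while p ≤ d.
module Submission where

open import Defs
open import Data.Nat using (ℕ; _≤_; zero; suc)
open import Data.Integer using (ℤ; +_)
open import Data.Nat.Properties using (n≤1+n)
import Data.Integer as ℤ
import Data.Integer.Properties as ℤ
open import Data.Fin using (Fin; zero; suc; inject₁; fromℕ; _≟_)
open import Data.Fin.Properties using (inject₁-injective; fromℕ≢inject₁)
open import Data.Fin.Relation.Unary.Top using (view; ‵fromℕ; ‵inj₁; ‵inject₁)
open import Data.Vec using (Vec; []; _∷_; lookup; tabulate; updateAt; _∷ʳ_; initLast)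
open import Data.Vec.Properties
  using (lookup∘tabulate; tabulate∘lookup; tabulate-cong; map-∷ʳ; last-∷ʳ; ∷ʳ-injectiveˡ; ∷ʳ-injectiveʳ)
open import Data.Product using (_×_; ∃; _,_; proj₁; proj₂)
open import Data.Sum using (_⊎_; inj₁; inj₂)
open import Data.Empty using (⊥-elim)
open import Function using (_∘_)
open import Relation.Nullary using (yes; no; ¬_)
open import Relation.Binary.PropositionalEquality
open import Relation.Binary.Definitions using (Irreflexive)

private
  variable
    A : Set
    m n p k : ℕ

≗⇒≡ : {xs ys : Vec A m} → (∀ i → lookup xs i ≡ lookup ys i) → xs ≡ ys
≗⇒≡ {xs = xs} {ys} eq = begin
  xs                   ≡⟨ sym (tabulate∘lookup xs) ⟩
  tabulate (lookup xs) ≡⟨ tabulate-cong eq ⟩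
  tabulate (lookup ys) ≡⟨ tabulate∘lookup ys ⟩
  ys                   ∎
  where open ≡-Reasoning

lookup-∷ʳ-inject₁ : (xs : Vec A m) (x : A) (i : Fin m) → lookup (xs ∷ʳ x) (inject₁ i) ≡ lookup xs i
lookup-∷ʳ-inject₁ (y ∷ xs) x zero    = refl
lookup-∷ʳ-inject₁ (y ∷ xs) x (suc i) = lookup-∷ʳ-inject₁ xs x i

lookup-∷ʳ-fromℕ : (xs : Vec A m) (x : A) → lookup (xs ∷ʳ x) (fromℕ m) ≡ x
lookup-∷ʳ-fromℕ []       x = refl
lookup-∷ʳ-fromℕ (y ∷ xs) x = lookup-∷ʳ-fromℕ xs x

swapIx-matchˡ : (i j : Fin m) → swapIx i j i ≡ j
swapIx-matchˡ i j with i ≟ i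
... | yes _  = refl
... | no i≢i = ⊥-elim (i≢i refl)

swapIx-matchʳ : (i j : Fin m) → swapIx i j j ≡ i
swapIx-matchʳ i j with j ≟ i
... | yes refl = refl
... | no _ with j ≟ j
...   | yes _  = refl
...   | no j≢j = ⊥-elim (j≢j refl)

swapIx-other : (i j r : Fin m) → r ≢ i → r ≢ j → swapIx i j r ≡ r
swapIx-other i j r r≢i r≢j with r ≟ i
... | yes r≡i = ⊥-elim (r≢i r≡i)
... | no _ with r ≟ j
...   | yes r≡j = ⊥-elim (r≢j r≡j)
...   | no _    = refl

swapIx-inject₁ : (i j r : Fin m) → swapIx (inject₁ i) (inject₁ j) (inject₁ r) ≡ inject₁ (swapIx i j r)
swapIx-inject₁ i j r with r ≟ i
... | yes refl = swapIx-matchˡ (inject₁ r) (inject₁ j)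
... | no r≢i with r ≟ j
...   | yes refl = swapIx-matchʳ (inject₁ i) (inject₁ r)
...   | no r≢j   = swapIx-other _ _ _ (r≢i ∘ inject₁-injective) (r≢j ∘ inject₁-injective)

swapIx-inject₁-fromℕ : (i j : Fin m) → swapIx (inject₁ i) (inject₁ j) (fromℕ m) ≡ fromℕ m
swapIx-inject₁-fromℕ i j = swapIx-other _ _ _ fromℕ≢inject₁ fromℕ≢inject₁

lookup-swapRows : ∀ (i j : Fin m) (X : Matrix m n) r → lookup (swapRows i j X) r ≡ lookup X (swapIx i j r)
lookup-swapRows i j X = lookup∘tabulate (lookup X ∘ swapIx i j)

negRow-∷ʳ : (i : Fin m) (X : Matrix m n) (w : Vec ℤ n) → negRow (inject₁ i) (X ∷ʳ w) ≡ negRow i X ∷ʳ w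
negRow-∷ʳ zero    (x ∷ X) w = refl
negRow-∷ʳ (suc i) (x ∷ X) w = cong (x ∷_) (negRow-∷ʳ i X w)

swapRows-∷ʳ : (i j : Fin m) (X : Matrix m n) (w : Vec ℤ n) →
              swapRows (inject₁ i) (inject₁ j) (X ∷ʳ w) ≡ swapRows i j X ∷ʳ w
swapRows-∷ʳ {m} i j X w = ≗⇒≡ pointwise
  where
  open ≡-Reasoning
  pointwise : ∀ r → lookup (swapRows (inject₁ i) (inject₁ j) (X ∷ʳ w)) r ≡ lookup (swapRows i j X ∷ʳ w) r
  pointwise r with view r
  ... | ‵inject₁ s = begin
    lookup (swapRows (inject₁ i) (inject₁ j) (X ∷ʳ w)) (inject₁ s) ≡⟨ lookup-swapRows _ _ (X ∷ʳ w) (inject₁ s) ⟩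
    lookup (X ∷ʳ w) (swapIx (inject₁ i) (inject₁ j) (inject₁ s))   ≡⟨ cong (lookup (X ∷ʳ w)) (swapIx-inject₁ i j s) ⟩
    lookup (X ∷ʳ w) (inject₁ (swapIx i j s))                       ≡⟨ lookup-∷ʳ-inject₁ X w _ ⟩
    lookup X (swapIx i j s)                                        ≡⟨ lookup-swapRows i j X s ⟨
    lookup (swapRows i j X) s                                      ≡⟨ lookup-∷ʳ-inject₁ (swapRows i j X) w s ⟨
    lookup (swapRows i j X ∷ʳ w) (inject₁ s)                       ∎
  ... | ‵fromℕ = begin
    lookup (swapRows (inject₁ i) (inject₁ j) (X ∷ʳ w)) (fromℕ m) ≡⟨ lookup-swapRows _ _ (X ∷ʳ w) (fromℕ m) ⟩
    lookup (X ∷ʳ w) (swapIx (inject₁ i) (inject₁ j) (fromℕ m))   ≡⟨ cong (lookup (X ∷ʳ w)) (swapIx-inject₁-fromℕ i j) ⟩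
    lookup (X ∷ʳ w) (fromℕ m)                                    ≡⟨ lookup-∷ʳ-fromℕ X w ⟩
    w                                                            ≡⟨ lookup-∷ʳ-fromℕ (swapRows i j X) w ⟨
    lookup (swapRows i j X ∷ʳ w) (fromℕ m)                       ∎

HEquiv-≡ˡ : {X X′ Z : Matrix m n} → X ≡ X′ → HEquiv X′ Z → HEquiv X Z
HEquiv-≡ˡ refl X′~Z = X′~Z

HEquiv-∷ʳ : {X Y : Matrix m n} (w : Vec ℤ n) → HEquiv X Y → ∃ λ v → HEquiv (X ∷ʳ w) (Y ∷ʳ v)
HEquiv-∷ʳ w done = w , done
HEquiv-∷ʳ {X = X} w (negRow⟶ i X~Y) =
  let v , Xw~Yv = HEquiv-∷ʳ w X~Y
  in  v , negRow⟶ (inject₁ i) (HEquiv-≡ˡ (negRow-∷ʳ i X w) Xw~Yv)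
HEquiv-∷ʳ {X = X} w (negCol⟶ j X~Y) =
  let v , Xw~Yv = HEquiv-∷ʳ (updateAt w j (ℤ.-_)) X~Y
  in  v , negCol⟶ j (HEquiv-≡ˡ (map-∷ʳ _ w X) Xw~Yv)
HEquiv-∷ʳ {X = X} w (swapRow⟶ i i′ X~Y) =
  let v , Xw~Yv = HEquiv-∷ʳ w X~Y
  in  v , swapRow⟶ (inject₁ i) (inject₁ i′) (HEquiv-≡ˡ (swapRows-∷ʳ i i′ X w) Xw~Yv)
HEquiv-∷ʳ {X = X} w (swapCol⟶ j j′ X~Y) =
  let v , Xw~Yv = HEquiv-∷ʳ (tabulate (lookup w ∘ swapIx j j′)) X~Y
  in  v , swapCol⟶ j j′ (HEquiv-≡ˡ (map-∷ʳ _ w X) Xw~Yv)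

module _ {R : A → A → Set} where

  Lex<-irrefl : Irreflexive _≡_ R → (xs : Vec A m) → ¬ Lex< R xs xs
  Lex<-irrefl irr (x ∷ xs) (inj₁ x<x)        = irr refl x<x
  Lex<-irrefl irr (x ∷ xs) (inj₂ (_ , xs<xs)) = Lex<-irrefl irr xs xs<xs

  Lex<-∷ʳ⁻¹ : (xs ys : Vec A m) (x y : A) → Lex< R (xs ∷ʳ x) (ys ∷ʳ y) → xs ≡ ys ⊎ Lex< R xs ys
  Lex<-∷ʳ⁻¹ []       []       x y _                   = inj₁ refl
  Lex<-∷ʳ⁻¹ (a ∷ xs) (b ∷ ys) x y (inj₁ a<b)          = inj₂ (inj₁ a<b)
  Lex<-∷ʳ⁻¹ (a ∷ xs) (a ∷ ys) x y (inj₂ (refl , lt)) with Lex<-∷ʳ⁻¹ xs ys x y lt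
  ... | inj₁ xs≡ys = inj₁ (cong (a ∷_) xs≡ys)
  ... | inj₂ xs<ys = inj₂ (inj₂ (refl , xs<ys))

  Lex<-swapLast₂ : Irreflexive _≡_ R → (zs : Vec A m) (x y : A) →
                   Lex< R (zs ∷ʳ x ∷ʳ y) (zs ∷ʳ y ∷ʳ x) → R x y ⊎ x ≡ y
  Lex<-swapLast₂ irr []       x y (inj₁ x<y)       = inj₁ x<y
  Lex<-swapLast₂ irr []       x y (inj₂ (x≡y , _)) = inj₂ x≡y
  Lex<-swapLast₂ irr (z ∷ zs) x y (inj₁ z<z)       = ⊥-elim (irr refl z<z)
  Lex<-swapLast₂ irr (z ∷ zs) x y (inj₂ (_ , lt))  = Lex<-swapLast₂ irr zs x y lt

≤R-∷ʳ⁻¹ : (X Y : Matrix m n) (v w : Vec ℤ n) → (X ∷ʳ v) ≤R (Y ∷ʳ w) → X ≤R Y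
≤R-∷ʳ⁻¹ X Y v w (inj₁ Xv≡Yw) = inj₁ (∷ʳ-injectiveˡ X Y Xv≡Yw)
≤R-∷ʳ⁻¹ X Y v w (inj₂ Xv<Yw) = Lex<-∷ʳ⁻¹ X Y v w Xv<Yw

<ᵥ-irrefl : Irreflexive _≡_ (_<ᵥ_ {n})
<ᵥ-irrefl {x = v} refl = Lex<-irrefl ℤ.<-irrefl v

≤R-swapLast₂ : (Z : Matrix m n) (v w : Vec ℤ n) → (Z ∷ʳ v ∷ʳ w) ≤R (Z ∷ʳ w ∷ʳ v) → v <ᵥ w ⊎ v ≡ w
≤R-swapLast₂ Z v w (inj₁ eq) = inj₂ (sym (∷ʳ-injectiveʳ (Z ∷ʳ v) (Z ∷ʳ w) eq))
≤R-swapLast₂ Z v w (inj₂ lt) = Lex<-swapLast₂ <ᵥ-irrefl Z v w lt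

Minimal-∷ʳ⁻¹ : (X : Matrix m n) (w : Vec ℤ n) → Minimal (X ∷ʳ w) → Minimal X
Minimal-∷ʳ⁻¹ X w min Y X~Y =
  let v , Xw~Yv = HEquiv-∷ʳ w X~Y
  in  ≤R-∷ʳ⁻¹ X Y w v (min (Y ∷ʳ v) Xw~Yv)

swapRows-last₂ : (Z : Matrix p n) (v w : Vec ℤ n) →
                 swapRows (inject₁ (fromℕ p)) (fromℕ (suc p)) (Z ∷ʳ v ∷ʳ w) ≡ Z ∷ʳ w ∷ʳ v
swapRows-last₂ {p} Z v w = ≗⇒≡ λ r → trans (lookup-swapRows _ _ (Z ∷ʳ v ∷ʳ w) r) (pointwise r)
  where
  open ≡-Reasoning
  i j : Fin (suc (suc p))
  i = inject₁ (fromℕ p)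
  j = fromℕ (suc p)
  pointwise : ∀ r → lookup (Z ∷ʳ v ∷ʳ w) (swapIx i j r) ≡ lookup (Z ∷ʳ w ∷ʳ v) r
  pointwise r with view r
  ... | ‵fromℕ = begin
    lookup (Z ∷ʳ v ∷ʳ w) (swapIx i j j) ≡⟨ cong (lookup (Z ∷ʳ v ∷ʳ w)) (swapIx-matchʳ i j) ⟩
    lookup (Z ∷ʳ v ∷ʳ w) i              ≡⟨ lookup-∷ʳ-inject₁ (Z ∷ʳ v) w (fromℕ p) ⟩
    lookup (Z ∷ʳ v) (fromℕ p)           ≡⟨ lookup-∷ʳ-fromℕ Z v ⟩
    v                                   ≡⟨ lookup-∷ʳ-fromℕ (Z ∷ʳ w) v ⟨
    lookup (Z ∷ʳ w ∷ʳ v) j              ∎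
  ... | ‵inj₁ ‵fromℕ = begin
    lookup (Z ∷ʳ v ∷ʳ w) (swapIx i j i) ≡⟨ cong (lookup (Z ∷ʳ v ∷ʳ w)) (swapIx-matchˡ i j) ⟩
    lookup (Z ∷ʳ v ∷ʳ w) j              ≡⟨ lookup-∷ʳ-fromℕ (Z ∷ʳ v) w ⟩
    w                                   ≡⟨ lookup-∷ʳ-fromℕ Z w ⟨
    lookup (Z ∷ʳ w) (fromℕ p)           ≡⟨ lookup-∷ʳ-inject₁ (Z ∷ʳ w) v (fromℕ p) ⟨
    lookup (Z ∷ʳ w ∷ʳ v) i              ∎
  ... | ‵inj₁ (‵inject₁ s) = begin
    lookup (Z ∷ʳ v ∷ʳ w) (swapIx i j s′) ≡⟨ cong (lookup (Z ∷ʳ v ∷ʳ w)) (swapIx-other i j s′ s′≢i s′≢j) ⟩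
    lookup (Z ∷ʳ v ∷ʳ w) s′              ≡⟨ lookup-∷ʳ-inject₁ (Z ∷ʳ v) w (inject₁ s) ⟩
    lookup (Z ∷ʳ v) (inject₁ s)          ≡⟨ lookup-∷ʳ-inject₁ Z v s ⟩
    lookup Z s                           ≡⟨ lookup-∷ʳ-inject₁ Z w s ⟨
    lookup (Z ∷ʳ w) (inject₁ s)          ≡⟨ lookup-∷ʳ-inject₁ (Z ∷ʳ w) v (inject₁ s) ⟨
    lookup (Z ∷ʳ w ∷ʳ v) s′              ∎
    where
    s′ : Fin (suc (suc p))
    s′ = inject₁ (inject₁ s)
    s′≢i : s′ ≢ i
    s′≢i = fromℕ≢inject₁ ∘ sym ∘ inject₁-injective
    s′≢j : s′ ≢ j
    s′≢j = fromℕ≢inject₁ ∘ sym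

Minimal⇒lastRows≤ : (Z : Matrix p n) (v w : Vec ℤ n) → Minimal (Z ∷ʳ v ∷ʳ w) → v <ᵥ w ⊎ v ≡ w
Minimal⇒lastRows≤ {p} Z v w min = ≤R-swapLast₂ Z v w
  (min (Z ∷ʳ w ∷ʳ v) (swapRow⟶ (inject₁ (fromℕ p)) (fromℕ (suc p)) (HEquiv-≡ˡ (swapRows-last₂ Z v w) done)))

OrthogonalToRows : Matrix p n → Vec ℤ n → Set
OrthogonalToRows X w = ∀ i → dot (lookup X i) w ≡ + 0

dot-comm : (v w : Vec ℤ n) → dot v w ≡ dot w v
dot-comm []      []      = refl
dot-comm (x ∷ v) (y ∷ w) = cong₂ ℤ._+_ (ℤ.*-comm x y) (dot-comm v w)

PIW-∷ʳ⁺ : (X : Matrix p n) (w : Vec ℤ n) →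
          PIW p n k X → dot w w ≡ + k → OrthogonalToRows X w → PIW (suc p) n k (X ∷ʳ w)
PIW-∷ʳ⁺ X w piw ww≡k X⊥w i j with view i | view j
... | ‵inject₁ a | ‵inject₁ b rewrite lookup-∷ʳ-inject₁ X w a | lookup-∷ʳ-inject₁ X w b =
  (proj₁ (piw a b) ∘ inject₁-injective) , (proj₂ (piw a b) ∘ (_∘ cong inject₁))
... | ‵inject₁ a | ‵fromℕ rewrite lookup-∷ʳ-inject₁ X w a | lookup-∷ʳ-fromℕ X w =
  (⊥-elim ∘ fromℕ≢inject₁ ∘ sym) , λ _ → X⊥w a
... | ‵fromℕ | ‵inject₁ b rewrite lookup-∷ʳ-inject₁ X w b | lookup-∷ʳ-fromℕ X w =
  (⊥-elim ∘ fromℕ≢inject₁) , λ _ → trans (dot-comm w _) (X⊥w b)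
... | ‵fromℕ | ‵fromℕ rewrite lookup-∷ʳ-fromℕ X w =
  (λ _ → ww≡k) , (λ i≢i → ⊥-elim (i≢i refl))

PIW-∷ʳ⁻ : (X : Matrix p n) (w : Vec ℤ n) →
          PIW (suc p) n k (X ∷ʳ w) → PIW p n k X × dot w w ≡ + k × OrthogonalToRows X w
PIW-∷ʳ⁻ {p} {n} {k} X w piw = piwX , ww≡k , X⊥w
  where
  piwX : PIW p n k X
  piwX a b with piw (inject₁ a) (inject₁ b)
  ... | diag , offDiag rewrite lookup-∷ʳ-inject₁ X w a | lookup-∷ʳ-inject₁ X w b =
    diag ∘ cong inject₁ , offDiag ∘ (_∘ inject₁-injective)
  ww≡k : dot w w ≡ + k
  ww≡k with piw (fromℕ p) (fromℕ p)
  ... | diag , _ rewrite lookup-∷ʳ-fromℕ X w = diag refl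
  X⊥w : OrthogonalToRows X w
  X⊥w a with piw (inject₁ a) (fromℕ p)
  ... | _ , offDiag rewrite lookup-∷ʳ-inject₁ X w a | lookup-∷ʳ-fromℕ X w = offDiag (fromℕ≢inject₁ ∘ sym)

orthogonal⇒≢ : (v w : Vec ℤ n) → 1 ≤ k → dot v v ≡ + k → dot v w ≡ + 0 → v ≢ w
orthogonal⇒≢ {k = suc _} v w _ vv≡k vw≡0 refl with trans (sym vv≡k) vw≡0
... | ()

PIW∧Minimal⇒lastRows< : (Z : Matrix p n) (v w : Vec ℤ n) → 1 ≤ k →
                        PIW (suc (suc p)) n k (Z ∷ʳ v ∷ʳ w) → Minimal (Z ∷ʳ v ∷ʳ w) → v <ᵥ w
PIW∧Minimal⇒lastRows< {p} Z v w 1≤k piw min with Minimal⇒lastRows≤ Z v w min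
... | inj₁ v<w = v<w
... | inj₂ v≡w =
  let piwZv , _ , Zv⊥w = PIW-∷ʳ⁻ (Z ∷ʳ v) w piw
      _ , vv≡k , _     = PIW-∷ʳ⁻ Z v piwZv
      vw≡0             = subst (λ u → dot u w ≡ + 0) (lookup-∷ʳ-fromℕ Z v) (Zv⊥w (fromℕ p))
  in  ⊥-elim (orthogonal⇒≢ v w 1≤k vv≡k vw≡0 v≡w)

RepL⇒PIW : {d : ℤ} {X : Matrix p n} → RepL n k d p X → PIW p n k X
RepL⇒PIW (start v vv≡k _)              = PIW-∷ʳ⁺ [] v (λ ()) vv≡k (λ ())
RepL⇒PIW (extend X w X∈L ww≡k _ X⊥w _) = PIW-∷ʳ⁺ X w (RepL⇒PIW X∈L) ww≡k X⊥w

RepL⇒Minimal : {d : ℤ} {X : Matrix (suc p) n} → RepL n k d (suc p) X → + p ℤ.≤ d → Minimal X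
RepL⇒Minimal (start _ _ min)           _   = min
RepL⇒Minimal (extend _ _ _ _ _ _ min) p≤d = min p≤d

PIW∧Minimal⇒RepL : (d : ℤ) → 1 ≤ k → (X : Matrix (suc p) n) → PIW (suc p) n k X → Minimal X → RepL n k d (suc p) X
PIW∧Minimal⇒RepL {p = zero}  d 1≤k (v ∷ []) piw min = start v (proj₁ (piw zero zero) refl) min
PIW∧Minimal⇒RepL {p = suc p} d 1≤k X piw min with initLast X
... | Y , w , refl with initLast Y
... | Z , v , refl =
  let piwZv , ww≡k , Zv⊥w = PIW-∷ʳ⁻ (Z ∷ʳ v) w piw
      Zv∈L = PIW∧Minimal⇒RepL d 1≤k (Z ∷ʳ v) piwZv (Minimal-∷ʳ⁻¹ (Z ∷ʳ v) w min)
      v<w  = PIW∧Minimal⇒lastRows< Z v w 1≤k piw min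
  in  extend (Z ∷ʳ v) w Zv∈L ww≡k (subst (_<ᵥ w) (sym (last-∷ʳ v Z)) v<w) Zv⊥w (λ _ → min)

mainTheorem6 : ∀ (m n k : ℕ) → 1 ≤ m → 1 ≤ n → 1 ≤ k →
    (∀ (X : Matrix m n) →
      (RepL n k (+ m) m X → PIW m n k X × Minimal X) ×
      (PIW m n k X × Minimal X → RepL n k (+ m) m X)) ×
    (∀ (d : ℤ) →
      (∀ (X : Matrix m n) → RepL n k d m X → PIW m n k X) ×
      (∀ (X : Matrix m n) → PIW m n k X → Minimal X → RepL n k d m X))
mainTheorem6 (suc p) n k _ _ 1≤k =
  (λ X → (λ X∈L → RepL⇒PIW X∈L , RepL⇒Minimal X∈L p≤1+p)
       , (λ (piw , min) → PIW∧Minimal⇒RepL (+ suc p) 1≤k X piw min))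
  , (λ d → (λ X → RepL⇒PIW) , PIW∧Minimal⇒RepL d 1≤k)
  where
  p≤1+p : + p ℤ.≤ + suc p
  p≤1+p = ℤ.+≤+ (n≤1+n p)
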